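{- Let $G$ be a connected graph with $\operatorname{diam}(G)=1$. Then there exist optimal strategies for Dominator and Staller in the edge domination game on $G$ such that in the resulting play $S$ (of length $\gamma_{e,g}(G)$), for every odd $i$ Dominator's edge $s_i$ covers exactly two vertices not in $C_{S,i-1}$ and for every even $i$ Staller's edge $s_i$ covers exactly one vertex not in $C_{S,i-1}$.
   Context: For a connected graph $G$ with at least one edge, the vertex-edge diameter is $\operatorname{diam}(G)=\max_{(v,u)\in E(G),\ w\in V(G)}\min\{\operatorname{dist}(w,v),\operatorname{dist}(w,u)\}$. For an edge $e$, $N[e]$ denotes $e$ together with all edges sharing an endpoint with $e$. In the edge domination game on $G$, Dominator and Staller alternately choose edges, Dominator first; each chosen edge $s_i$ must satisfy $N[s_i]\setminus\bigcup_{j<i}N[s_j]\neq\emptyset$; the game ends when all edges lie in $\bigcup_jN[s_j]$. Dominator minimizes and Staller maximizes the number of moves; $\gamma_{e,g}(G)$ is the number of moves under optimal play. For a play $S=s_1s_2\dots$, $C_{S,i}$ is the set of endpoints of $s_1,\dots,s_i$, with $C_{S,0}=\emptyset$. -}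

module Defs where

open import Data.Nat using (ℕ; zero; suc; _≤_; _<_)
open import Data.Fin using (Fin)
open import Data.Bool using (Bool; true; false; not)
open import Data.List using (List; []; _∷_; _++_; [_]; length)
open import Data.List.Membership.Propositional using (_∈_)
open import Data.Product using (Σ; ∃; ∃-syntax; _×_; _,_)
open import Data.Sum using (_⊎_)
open import Relation.Nullary using (¬_)
open import Relation.Binary.PropositionalEquality using (_≡_)

record Graph : Set where
  field
    n      : ℕ
    adj    : Fin n → Fin n → Bool
    sym    : ∀ u v → adj u v ≡ adj v u
    irrefl : ∀ u → adj u u ≡ false

module _ (G : Graph) where
  open Graph G

  Vertex : Set
  Vertex = Fin n

  record Edge : Set where
    constructor edge
    field
      end₁ end₂ : Vertex
      isAdj     : adj end₁ end₂ ≡ true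
  open Edge public

  -- Walks of a given length; dist(u,v) is the least length of a walk.
  data Walk : Vertex → Vertex → ℕ → Set where
    here : ∀ {u} → Walk u u zero
    step : ∀ {u v w k} → adj u v ≡ true → Walk v w k → Walk u w (suc k)

  Connected : Set
  Connected = ∀ u v → ∃[ k ] Walk u v k

  DistLe : Vertex → Vertex → ℕ → Set
  DistLe u v d = ∃[ k ] (k ≤ d × Walk u v k)

  DistGe : Vertex → Vertex → ℕ → Set
  DistGe u v d = ∀ k → Walk u v k → d ≤ k

  -- diam(G) = d, where diam(G) = max over edges e=(v,u) and vertices w of
  -- min{dist(w,v), dist(w,u)}: every such min is ≤ d, and some such min is ≥ d.
  VEDiam : ℕ → Set
  VEDiam d =
    (∀ (e : Edge) (w : Vertex) → DistLe w (end₁ e) d ⊎ DistLe w (end₂ e) d)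
    × (∃[ e ] ∃[ w ] (DistGe w (end₁ e) d × DistGe w (end₂ e) d))

  InN : Edge → Edge → Set
  InN f e = (end₁ f ≡ end₁ e ⊎ end₁ f ≡ end₂ e) ⊎ (end₂ f ≡ end₁ e ⊎ end₂ f ≡ end₂ e)

  History : Set
  History = List Edge

  Dominated : History → Edge → Set
  Dominated h f = ∃[ e ] (e ∈ h × InN f e)

  Over : History → Set
  Over h = ∀ f → Dominated h f

  Legal : History → Edge → Set
  Legal h s = ∃[ f ] (InN f s × ¬ Dominated h f)

  isDTurn : ℕ → Bool
  isDTurn zero    = true
  isDTurn (suc k) = not (isDTurn k)

  Strategy : Set
  Strategy = (h : History) → .(¬ Over h) → Σ Edge (Legal h)

  data Play (σD σS : Strategy) : History → History → Set where
    done   : ∀ {h} → Over h → Play σD σS h h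
    moveD  : ∀ {h S} → isDTurn (length h) ≡ true → .(nov : ¬ Over h) →
             Play σD σS (h ++ [ Σ.proj₁ (σD h nov) ]) S → Play σD σS h S
    moveS  : ∀ {h S} → isDTurn (length h) ≡ false → .(nov : ¬ Over h) →
             Play σD σS (h ++ [ Σ.proj₁ (σS h nov) ]) S → Play σD σS h S

  DGuarantees : Strategy → ℕ → Set
  DGuarantees σD k = ∀ σS S → Play σD σS [] S → length S ≤ k

  SGuarantees : Strategy → ℕ → Set
  SGuarantees σS k = ∀ σD S → Play σD σS [] S → k ≤ length S

  GameValue : ℕ → Set
  GameValue k = (∃[ σD ] DGuarantees σD k) × (∃[ σS ] SGuarantees σS k)

  InC : History → Vertex → Set
  InC h x = ∃[ e ] (e ∈ h × (x ≡ end₁ e ⊎ x ≡ end₂ e))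

  CoversTwoNew : History → Edge → Set
  CoversTwoNew h s = ¬ InC h (end₁ s) × ¬ InC h (end₂ s)

  CoversOneNew : History → Edge → Set
  CoversOneNew h s = (InC h (end₁ s) × ¬ InC h (end₂ s))
                   ⊎ (¬ InC h (end₁ s) × InC h (end₂ s))

  -- For S = s₁ s₂ …: for odd i, sᵢ covers two new vertices;
  -- for even i, sᵢ covers exactly one new vertex.
  -- (pre = s₁…s_{i-1}; i odd ⇔ length pre even ⇔ isDTurn (length pre) ≡ true)
  PatternProperty : History → Set
  PatternProperty S = ∀ pre s post → S ≡ pre ++ s ∷ post →
    (isDTurn (length pre) ≡ true  → CoversTwoNew pre s) ×
    (isDTurn (length pre) ≡ false → CoversOneNew pre s)

-- The value of a position depends only on the set of dominated edges and can only decrease when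
-- that set grows (the continuation principle, value-antitone). Hence an optimal Dominator move s
-- with a covered endpoint can be traded for the undominated edge f ∈ N[s] that makes s legal: f has
-- two new endpoints and dominates everything that s newly dominates. Dually, once a move has been
-- played, diam(G) ≤ 1 makes every uncovered vertex adjacent to a covered one, so an optimal Staller
-- move with two new endpoints can be traded for the edge joining one of them to C(h), which
-- dominates less and covers exactly one new vertex. Strategies that always make such optimal moves
-- realise the value of the game and produce the required play.

module Submission where

open import Defs
open import Data.Nat using (ℕ; zero; suc; _+_; _≤_; _<_; z≤n; s≤s)
open import Data.Nat.Properties
  using (≤-refl; ≤-reflexive; ≤-trans; ≤-antisym; ≤-pred; <-≤-trans; m≤n⇒m≤1+n; m<n⇒m<1+n; m≤m+n; +-suc; +-identityʳ; +-monoʳ-≤; module ≤-Reasoning)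
open import Level using (0ℓ)
open import Data.Bool using (Bool; true; false; not)
open import Data.List using (List; []; _∷_; _++_; [_]; length; filter; concatMap; allFin)
open import Data.List.Properties using (length-++-comm; ++-assoc; ++-identityʳ; ++-identityʳ-unique; ++-conicalʳ; ++-cancelˡ; ∷-injectiveˡ)
open import Data.List.Membership.Propositional using (_∈_; find; lose)
open import Data.List.Membership.Propositional.Properties using (∈-++⁺ˡ; ∈-++⁺ʳ; ∈-++⁻; ∈-filter⁺; ∈-filter⁻; ∈-concatMap⁺; ∈-allFin)
open import Data.List.Relation.Unary.Any using (here; there; any?)
open import Data.List.Extrema.Nat using (argmin; argmax; argmin-sel; argmax-sel; f[argmin]≤f[⊤]; f[argmin]≤f[xs]; f[⊥]≤f[argmax]; f[xs]≤f[argmax])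
import Data.List.Relation.Unary.All as All
open import Data.Fin using (_≟_)
open import Data.Product using (Σ; ∃-syntax; _×_; _,_; proj₁; proj₂)
open import Data.Sum using (_⊎_; inj₁; inj₂; [_,_]′)
import Data.Sum as Sum
import Data.Empty.Irrelevant as Irrelevant
open import Function using (id; _∘_)
open import Relation.Unary using (Pred; Decidable; _⊆_)
open import Relation.Nullary using (¬_; Dec; yes; no; contradiction)
open import Relation.Nullary.Decidable using (_⊎-dec_; _×-dec_; ¬?; map′; decidable-stable)
open import Relation.Binary.PropositionalEquality using (_≡_; _≢_; refl; sym; trans; cong; subst; module ≡-Reasoning)
open import Axiom.UniquenessOfIdentityProofs.WithK using (uip)

module _ {A : Set} {P Q : Pred A 0ℓ} (P? : Decidable P) (Q? : Decidable Q) (P⊆Q : P ⊆ Q) where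

  length-filter-mono : ∀ xs → length (filter P? xs) ≤ length (filter Q? xs)
  length-filter-mono []       = z≤n
  length-filter-mono (x ∷ xs) with P? x | Q? x
  ... | yes _  | yes _  = s≤s (length-filter-mono xs)
  ... | yes px | no ¬qx = contradiction (P⊆Q px) ¬qx
  ... | no _   | yes _  = m≤n⇒m≤1+n (length-filter-mono xs)
  ... | no _   | no _   = length-filter-mono xs

  length-filter-< : ∀ {y} xs → y ∈ xs → ¬ P y → Q y → length (filter P? xs) < length (filter Q? xs)
  length-filter-< (x ∷ xs) (here refl) ¬px qx with P? x | Q? x
  ... | yes px | _      = contradiction px ¬px
  ... | no _   | yes _  = s≤s (length-filter-mono xs)
  ... | no _   | no ¬qx = contradiction qx ¬qx
  length-filter-< (x ∷ xs) (there y∈xs) ¬py qy with P? x | Q? x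
  ... | yes _  | yes _  = s≤s (length-filter-< xs y∈xs ¬py qy)
  ... | yes px | no ¬qx = contradiction (P⊆Q px) ¬qx
  ... | no _   | yes _  = m<n⇒m<1+n (length-filter-< xs y∈xs ¬py qy)
  ... | no _   | no _   = length-filter-< xs y∈xs ¬py qy

snoc-prefix-head : ∀ {A : Set} (h : List A) {m y xs ys} → h ++ y ∷ xs ≡ (h ++ [ m ]) ++ ys → y ≡ m
snoc-prefix-head h {m} {ys = ys} eq = ∷-injectiveˡ (++-cancelˡ h _ _ (trans eq (++-assoc h [ m ] ys)))

module _ {A : Set} where

  best : Bool → (A → ℕ) → A → List A → A
  best true  = argmin
  best false = argmax

  optimum : Bool → (A → ℕ) → A → List A → ℕ
  optimum t g ⊤ xs = g (best t g ⊤ xs)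

  best-∈ : ∀ t g ⊤ xs → best t g ⊤ xs ∈ ⊤ ∷ xs
  best-∈ true  g ⊤ xs = [ here , there ]′ (argmin-sel g ⊤ xs)
  best-∈ false g ⊤ xs = [ here , there ]′ (argmax-sel g ⊤ xs)

  optimum-min : ∀ g {⊤ xs y} → y ∈ ⊤ ∷ xs → optimum true g ⊤ xs ≤ g y
  optimum-min g {⊤} {xs} (here refl) = f[argmin]≤f[⊤] {f = g} ⊤ xs
  optimum-min g {⊤} {xs} (there y∈xs) = All.lookup (f[argmin]≤f[xs] {f = g} ⊤ xs) y∈xs

  optimum-max : ∀ g {⊤ xs y} → y ∈ ⊤ ∷ xs → g y ≤ optimum false g ⊤ xs
  optimum-max g {⊤} {xs} (here refl) = f[⊥]≤f[argmax] {f = g} ⊤ xs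
  optimum-max g {⊤} {xs} (there y∈xs) = All.lookup (f[xs]≤f[argmax] {f = g} ⊤ xs) y∈xs

  optimum-cong : ∀ t {g g'} ⊤ xs → (∀ {y} → y ∈ ⊤ ∷ xs → g y ≡ g' y) → optimum t g ⊤ xs ≡ optimum t g' ⊤ xs
  optimum-cong true {g} {g'} ⊤ xs g≗g' = ≤-antisym
    (≤-trans (optimum-min g (best-∈ true g' ⊤ xs)) (≤-reflexive (g≗g' (best-∈ true g' ⊤ xs))))
    (≤-trans (optimum-min g' (best-∈ true g ⊤ xs)) (≤-reflexive (sym (g≗g' (best-∈ true g ⊤ xs)))))
  optimum-cong false {g} {g'} ⊤ xs g≗g' = ≤-antisym
    (≤-trans (≤-reflexive (g≗g' (best-∈ false g ⊤ xs))) (optimum-max g' (best-∈ false g ⊤ xs)))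
    (≤-trans (≤-reflexive (sym (g≗g' (best-∈ false g' ⊤ xs)))) (optimum-max g (best-∈ false g' ⊤ xs)))

walk-length≤1 : ∀ {G : Graph} {x u k} → Walk G x u k → k ≤ 1 → x ≡ u ⊎ Graph.adj G x u ≡ true
walk-length≤1 here                _           = inj₁ refl
walk-length≤1 (step xu here)      _           = inj₂ xu
walk-length≤1 (step _ (step _ _)) (s≤s ())

module EdgeGame (G : Graph) where
  open Graph G using (n; adj)

  private
    variable
      h h' S : History G
      s s' f : Edge G
      x : Vertex G
      t : Bool

  Incident : Edge G → Vertex G → Set
  Incident e x = x ≡ end₁ e ⊎ x ≡ end₂ e

  Undominated : History G → Set
  Undominated h = ∃[ f ] ¬ Dominated G h f

  turn : History G → Bool
  turn h = isDTurn G (length h)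

  move : Strategy G → (h : History G) → .(¬ Over G h) → Edge G
  move σ h ¬over = proj₁ (σ h ¬over)

  covered⇒dominated : Incident f x → InC G h x → Dominated G h f
  covered⇒dominated (inj₁ refl) (e , e∈h , i) = e , e∈h , inj₁ i
  covered⇒dominated (inj₂ refl) (e , e∈h , i) = e , e∈h , inj₂ i

  dominated⇒covered : Dominated G h f → InC G h (end₁ f) ⊎ InC G h (end₂ f)
  dominated⇒covered (e , e∈h , inj₁ i) = inj₁ (e , e∈h , i)
  dominated⇒covered (e , e∈h , inj₂ i) = inj₂ (e , e∈h , i)

  undominated⇒uncovered : ¬ Dominated G h f → Incident f x → ¬ InC G h x
  undominated⇒uncovered {f = f} ¬dom i c = ¬dom (covered⇒dominated {f = f} i c)

  uncovered⇒undominated : ¬ InC G h (end₁ f) → ¬ InC G h (end₂ f) → ¬ Dominated G h f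
  uncovered⇒undominated {f = f} ¬c₁ ¬c₂ = [ ¬c₁ , ¬c₂ ]′ ∘ dominated⇒covered {f = f}

  undominated-touches-other-end : ∀ {a b} → ¬ Dominated G h f →
    (end₁ f ≡ a ⊎ end₁ f ≡ b) ⊎ (end₂ f ≡ a ⊎ end₂ f ≡ b) → InC G h a → Incident f b
  undominated-touches-other-end {f = f} ¬dom (inj₁ (inj₁ refl)) c = contradiction (covered⇒dominated {f = f} (inj₁ refl) c) ¬dom
  undominated-touches-other-end         ¬dom (inj₁ (inj₂ refl)) c = inj₁ refl
  undominated-touches-other-end {f = f} ¬dom (inj₂ (inj₁ refl)) c = contradiction (covered⇒dominated {f = f} (inj₂ refl) c) ¬dom
  undominated-touches-other-end         ¬dom (inj₂ (inj₂ refl)) c = inj₂ refl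

  legal⇒undominated : Legal G h s → Undominated h
  legal⇒undominated (f , _ , ¬dom) = f , ¬dom

  undominated⇒legal : ¬ Dominated G h f → Legal G h f
  undominated⇒legal {f = f} ¬dom = f , inj₁ (inj₁ refl) , ¬dom

  legal⇒uncovered-endpoint : Legal G h s → ∃[ x ] (Incident s x × ¬ InC G h x)
  legal⇒uncovered-endpoint (f , inj₁ i , ¬dom) = end₁ f , i , undominated⇒uncovered {f = f} ¬dom (inj₁ refl)
  legal⇒uncovered-endpoint (f , inj₂ i , ¬dom) = end₂ f , i , undominated⇒uncovered {f = f} ¬dom (inj₂ refl)

  legal⇒not-both-covered : Legal G h s → ¬ (InC G h (end₁ s) × InC G h (end₂ s))
  legal⇒not-both-covered {s = s} L (c₁ , c₂) with legal⇒uncovered-endpoint {s = s} L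
  ... | _ , inj₁ refl , ¬c = ¬c c₁
  ... | _ , inj₂ refl , ¬c = ¬c c₂

  covered-snoc⁺ˡ : InC G h x → InC G (h ++ [ s ]) x
  covered-snoc⁺ˡ (e , e∈h , i) = e , ∈-++⁺ˡ e∈h , i

  covered-snoc⁺ʳ : Incident s x → InC G (h ++ [ s ]) x
  covered-snoc⁺ʳ {h = h} i = _ , ∈-++⁺ʳ h (here refl) , i

  covered-snoc⁻ : InC G (h ++ [ s ]) x → InC G h x ⊎ Incident s x
  covered-snoc⁻ {h = h} (e , e∈ , i) with ∈-++⁻ h e∈
  ... | inj₁ e∈h         = inj₁ (e , e∈h , i)
  ... | inj₂ (here refl) = inj₂ i

  dominated-snoc⁺ˡ : Dominated G h f → Dominated G (h ++ [ s ]) f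
  dominated-snoc⁺ˡ (e , e∈h , f∼e) = e , ∈-++⁺ˡ e∈h , f∼e

  dominated-snoc⁺ʳ : InN G f s → Dominated G (h ++ [ s ]) f
  dominated-snoc⁺ʳ {h = h} f∼s = _ , ∈-++⁺ʳ h (here refl) , f∼s

  dominated-snoc⁻ : Dominated G (h ++ [ s ]) f → Dominated G h f ⊎ InN G f s
  dominated-snoc⁻ {h = h} (e , e∈ , f∼e) with ∈-++⁻ h e∈
  ... | inj₁ e∈h         = inj₁ (e , e∈h , f∼e)
  ... | inj₂ (here refl) = inj₂ f∼e

  incident? : ∀ e x → Dec (Incident e x)
  incident? e x = (x ≟ end₁ e) ⊎-dec (x ≟ end₂ e)

  neighbour? : ∀ f e → Dec (InN G f e)
  neighbour? f e = incident? e (end₁ f) ⊎-dec incident? e (end₂ f)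

  covered? : ∀ h x → Dec (InC G h x)
  covered? h x = map′ find (λ (e , e∈h , i) → lose e∈h i) (any? (λ e → incident? e x) h)

  dominated? : ∀ h f → Dec (Dominated G h f)
  dominated? h f = map′ find (λ (e , e∈h , f∼e) → lose e∈h f∼e) (any? (neighbour? f) h)

  edgesWhen : ∀ {b} u v → adj u v ≡ b → List (Edge G)
  edgesWhen {true}  u v uv = [ edge u v uv ]
  edgesWhen {false} _ _ _  = []

  ∈-edgesWhen : ∀ {b u v} (uv : adj u v ≡ b) (p : adj u v ≡ true) → edge u v p ∈ edgesWhen u v uv
  ∈-edgesWhen {true}  {u} {v} uv p = here (cong (edge u v) (uip p uv))
  ∈-edgesWhen {false}         uv p = contradiction (trans (sym uv) p) λ ()

  edgesFrom : Vertex G → List (Edge G)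
  edgesFrom u = concatMap (λ v → edgesWhen u v refl) (allFin n)

  edges : List (Edge G)
  edges = concatMap edgesFrom (allFin n)

  ∈-edges : ∀ e → e ∈ edges
  ∈-edges (edge u v p) = ∈-concatMap⁺ edgesFrom (lose (∈-allFin u)
    (∈-concatMap⁺ (λ v → edgesWhen u v refl) (lose (∈-allFin v) (∈-edgesWhen refl p))))

  status : ∀ h → Over G h ⊎ Undominated h
  status h with any? (¬? ∘ dominated? h) edges
  ... | yes some = inj₂ (let f , _ , ¬dom = find some in f , ¬dom)
  ... | no none  = inj₁ λ f → decidable-stable (dominated? h f) (none ∘ lose (∈-edges f))

  undominated : ∀ h → .(¬ Over G h) → Undominated h
  undominated h ¬over = [ (λ over → Irrelevant.⊥-elim (¬over over)) , id ]′ (status h)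

  undominated⇒¬over : Undominated h → ¬ Over G h
  undominated⇒¬over (f , ¬dom) over = ¬dom (over f)

  legal? : ∀ h s → Dec (Legal G h s)
  legal? h s = map′ (λ some → let f , _ , L = find some in f , L) (λ (f , L) → lose (∈-edges f) L)
    (any? (λ f → neighbour? f s ×-dec ¬? (dominated? h f)) edges)

  legalMoves : History G → List (Edge G)
  legalMoves h = filter (legal? h) edges

  ∈-legalMoves⁺ : Legal G h s → s ∈ legalMoves h
  ∈-legalMoves⁺ {h = h} {s = s} L = ∈-filter⁺ {P = Legal G h} (legal? h) (∈-edges s) L

  ∈-legalMoves⁻ : s ∈ legalMoves h → Legal G h s
  ∈-legalMoves⁻ {h = h} s∈ = proj₂ (∈-filter⁻ {P = Legal G h} (legal? h) {xs = edges} s∈)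

  uncovered : History G → ℕ
  uncovered h = length (filter (¬? ∘ covered? h) (allFin n))

  uncovered-snoc : Legal G h s → uncovered (h ++ [ s ]) < uncovered h
  uncovered-snoc {h = h} {s = s} L with legal⇒uncovered-endpoint {s = s} L
  ... | x , i , ¬c = length-filter-< (¬? ∘ covered? (h ++ [ s ])) (¬? ∘ covered? h)
                       (λ ¬c' c → ¬c' (covered-snoc⁺ˡ c)) (allFin n) (∈-allFin x)
                       (λ ¬c' → ¬c' (covered-snoc⁺ʳ i)) ¬c

  -- Minimax value of a position; true means Dominator is to move. The fuel suc (uncovered h)
  -- suffices by uncovered-snoc, and value is opaque so that unification never unfolds the game tree.

  mutual
    valueWith : ℕ → Bool → History G → ℕ
    valueWith zero    t h = 0
    valueWith (suc k) t h = valueAt k t h (status h)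

    valueAt : ℕ → Bool → (h : History G) → Over G h ⊎ Undominated h → ℕ
    valueAt k t h (inj₁ _)       = 0
    valueAt k t h (inj₂ (f , _)) = optimum t (λ s → suc (valueWith k (not t) (h ++ [ s ]))) f (legalMoves h)

  ∈-∷legalMoves⁻ : ¬ Dominated G h f → s ∈ f ∷ legalMoves h → Legal G h s
  ∈-∷legalMoves⁻ {f = f} ¬dom (here refl) = undominated⇒legal {f = f} ¬dom
  ∈-∷legalMoves⁻         ¬dom (there s∈)  = ∈-legalMoves⁻ s∈

  fuel-decreases : ∀ {k} → Legal G h s → uncovered h < suc k → uncovered (h ++ [ s ]) < k
  fuel-decreases {s = s} L bound = <-≤-trans (uncovered-snoc {s = s} L) (≤-pred bound)

  valueWith-fuel : ∀ {k k'} t h → uncovered h < k → uncovered h < k' → valueWith k t h ≡ valueWith k' t h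
  valueWith-fuel {suc k} {suc k'} t h bound bound' with status h
  ... | inj₁ _         = refl
  ... | inj₂ (f , ¬dom) = optimum-cong t f (legalMoves h) λ {s} s∈ →
    let L = ∈-∷legalMoves⁻ {f = f} ¬dom s∈ in
    cong suc (valueWith-fuel (not t) (h ++ [ s ]) (fuel-decreases {s = s} L bound) (fuel-decreases {s = s} L bound'))

  opaque
    value : Bool → History G → ℕ
    value t h = valueWith (suc (uncovered h)) t h

  valueAfter : Bool → History G → Edge G → ℕ
  valueAfter t h s = suc (value (not t) (h ++ [ s ]))

  OptimalMove : Bool → History G → Edge G → Set
  OptimalMove t h s = value t h ≡ valueAfter t h s

  opaque
    unfolding value

    value-over : Over G h → value t h ≡ 0
    value-over {h = h} over with status h
    ... | inj₁ _         = refl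
    ... | inj₂ (f , ¬dom) = contradiction (over f) ¬dom

    value-unfold : Undominated h →
      ∃[ f ] (¬ Dominated G h f × value t h ≡ optimum t (valueAfter t h) f (legalMoves h))
    value-unfold {h = h} {t = t} (g , ¬dom-g) with status h
    ... | inj₁ over         = contradiction (over g) ¬dom-g
    ... | inj₂ (f , ¬dom) = f , ¬dom , optimum-cong t f (legalMoves h) λ {s} s∈ →
      cong suc (valueWith-fuel (not t) (h ++ [ s ]) (uncovered-snoc {s = s} (∈-∷legalMoves⁻ {f = f} ¬dom s∈)) ≤-refl)

  value-dominator-≤ : Legal G h s → value true h ≤ valueAfter true h s
  value-dominator-≤ {h = h} {s = s} L with value-unfold {t = true} (legal⇒undominated {s = s} L)
  ... | f , _ , eq = ≤-trans (≤-reflexive eq) (optimum-min (valueAfter true h) {f} {legalMoves h} (there (∈-legalMoves⁺ {s = s} L)))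

  value-staller-≥ : Legal G h s → valueAfter false h s ≤ value false h
  value-staller-≥ {h = h} {s = s} L with value-unfold {t = false} (legal⇒undominated {s = s} L)
  ... | f , _ , eq = ≤-trans (optimum-max (valueAfter false h) {f} {legalMoves h} (there (∈-legalMoves⁺ {s = s} L))) (≤-reflexive (sym eq))

  optimal-move : ∀ t → Undominated h → ∃[ s ] (Legal G h s × OptimalMove t h s)
  optimal-move {h = h} t u with value-unfold {t = t} u
  ... | f , ¬dom , eq = best t (valueAfter t h) f (legalMoves h) ,
                        ∈-∷legalMoves⁻ {f = f} ¬dom (best-∈ t (valueAfter t h) f (legalMoves h)) , eq

  _⊑_ : History G → History G → Set
  h ⊑ h' = ∀ f → Dominated G h f → Dominated G h' f

  ⊑-snoc : h ⊑ h' → (h ++ [ s ]) ⊑ (h' ++ [ s ])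
  ⊑-snoc {h = h} {h' = h'} {s = s} h⊑h' f dom with dominated-snoc⁻ {h = h} {s = s} {f = f} dom
  ... | inj₁ dom-h = dominated-snoc⁺ˡ {h = h'} {f = f} (h⊑h' f dom-h)
  ... | inj₂ f∼s   = dominated-snoc⁺ʳ {f = f} {h = h'} f∼s

  ⊑-snoc-illegal : h ⊑ h' → ¬ Legal G h' s → (h ++ [ s ]) ⊑ h'
  ⊑-snoc-illegal {h = h} {h' = h'} {s = s} h⊑h' ¬L f dom with dominated-snoc⁻ {h = h} {s = s} {f = f} dom
  ... | inj₁ dom-h = h⊑h' f dom-h
  ... | inj₂ f∼s   = decidable-stable (dominated? h' f) λ ¬dom → ¬L (f , f∼s , ¬dom)

  ⊑-snocʳ : h ⊑ (h ++ [ s ])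
  ⊑-snocʳ {h = h} f = dominated-snoc⁺ˡ {h = h} {f = f}

  ⊑-undominated : h ⊑ h' → Undominated h' → Undominated h
  ⊑-undominated h⊑h' (f , ¬dom) = f , ¬dom ∘ h⊑h' f

  legal-antitone : h ⊑ h' → Legal G h' s → Legal G h s
  legal-antitone h⊑h' (f , f∼s , ¬dom) = f , f∼s , ¬dom ∘ h⊑h' f

  Antitone : History G → Set
  Antitone h = ∀ t {h'} → h ⊑ h' → value t h' ≤ value t h

  -- Proved together with Antitone, whose case of a move illegal after h' needs it one move deeper.
  SwapBound : History G → Set
  SwapBound h = ∀ t → value t h ≤ suc (value (not t) h)

  private
    antitone-step : (∀ {s} → Legal G h s → Antitone (h ++ [ s ]) × SwapBound (h ++ [ s ])) → Antitone h
    antitone-step {h = h} ih t {h'} h⊑h' with status h'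
    ... | inj₁ over = ≤-trans (≤-reflexive (value-over over)) z≤n
    antitone-step {h = h} ih true {h'} h⊑h' | inj₂ u' with optimal-move true (⊑-undominated h⊑h' u')
    ... | s , L , opt with legal? h' s
    ...   | yes L' = begin
      value true h'                     ≤⟨ value-dominator-≤ {s = s} L' ⟩
      suc (value false (h' ++ [ s ]))   ≤⟨ s≤s (proj₁ (ih {s} L) false (⊑-snoc {s = s} h⊑h')) ⟩
      suc (value false (h ++ [ s ]))    ≡⟨ opt ⟨
      value true h                      ∎
      where open ≤-Reasoning
    ...   | no ¬L' = begin
      value true h'                     ≤⟨ proj₁ (ih {s} L) true (⊑-snoc-illegal {s = s} h⊑h' ¬L') ⟩
      value true (h ++ [ s ])           ≤⟨ proj₂ (ih {s} L) true ⟩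
      suc (value false (h ++ [ s ]))    ≡⟨ opt ⟨
      value true h                      ∎
      where open ≤-Reasoning
    antitone-step {h = h} ih false {h'} h⊑h' | inj₂ u' with optimal-move false u'
    ... | s , L' , opt = begin
      value false h'                    ≡⟨ opt ⟩
      suc (value true (h' ++ [ s ]))    ≤⟨ s≤s (proj₁ (ih {s} L) true (⊑-snoc {s = s} h⊑h')) ⟩
      suc (value true (h ++ [ s ]))     ≤⟨ value-staller-≥ {s = s} L ⟩
      value false h                     ∎
      where
      open ≤-Reasoning
      L : Legal G h s
      L = legal-antitone {s = s} h⊑h' L'

    swap-step : (∀ {s} → Legal G h s → Antitone (h ++ [ s ]) × SwapBound (h ++ [ s ])) → Antitone h → SwapBound h
    swap-step {h = h} ih antitone t with status h
    ... | inj₁ over = ≤-trans (≤-reflexive (value-over over)) z≤n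
    swap-step {h = h} ih antitone true | inj₂ u with optimal-move true u
    ... | s , L , opt = begin
      value true h                         ≡⟨ opt ⟩
      suc (value false (h ++ [ s ]))       ≤⟨ s≤s (proj₂ (ih {s} L) false) ⟩
      suc (suc (value true (h ++ [ s ])))  ≤⟨ s≤s (value-staller-≥ {s = s} L) ⟩
      suc (value false h)                  ∎
      where open ≤-Reasoning
    swap-step {h = h} ih antitone false | inj₂ u with optimal-move false u
    ... | s , L , opt = begin
      value false h                        ≡⟨ opt ⟩
      suc (value true (h ++ [ s ]))        ≤⟨ s≤s (antitone true (⊑-snocʳ {s = s})) ⟩
      suc (value true h)                   ∎
      where open ≤-Reasoning

    antitone-and-swap : ∀ k h → uncovered h < k → Antitone h × SwapBound h
    antitone-and-swap (suc k) h bound = antitone , swap-step ih antitone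
      where
      ih : ∀ {s} → Legal G h s → Antitone (h ++ [ s ]) × SwapBound (h ++ [ s ])
      ih {s} L = antitone-and-swap k (h ++ [ s ]) (fuel-decreases {s = s} L bound)
      antitone : Antitone h
      antitone = antitone-step ih

  value-antitone : ∀ t → h ⊑ h' → value t h' ≤ value t h
  value-antitone {h = h} t = proj₁ (antitone-and-swap (suc (uncovered h)) h ≤-refl) t

  covered-⊆⇒⊑ : (∀ {x} → InC G h x → InC G h' x) → h ⊑ h'
  covered-⊆⇒⊑ C⊆C' g dom = [ covered⇒dominated {f = g} (inj₁ refl) ∘ C⊆C' , covered⇒dominated {f = g} (inj₂ refl) ∘ C⊆C' ]′
    (dominated⇒covered {f = g} dom)

  snoc-⊑-snoc : (∀ {x} → Incident s x → InC G h x ⊎ Incident s' x) → (h ++ [ s ]) ⊑ (h ++ [ s' ])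
  snoc-⊑-snoc {h = h} covers = covered-⊆⇒⊑ λ c →
    [ covered-snoc⁺ˡ , [ covered-snoc⁺ˡ , covered-snoc⁺ʳ {h = h} ]′ ∘ covers ]′ (covered-snoc⁻ {h = h} c)

  optimal-by-cover : Legal G h f → OptimalMove true h s → (∀ {x} → Incident s x → InC G h x ⊎ Incident f x) →
    OptimalMove true h f
  optimal-by-cover {f = f} {s = s} L-f opt covers = ≤-antisym (value-dominator-≤ {s = f} L-f)
    (≤-trans (s≤s (value-antitone false (snoc-⊑-snoc {s = s} covers))) (≤-reflexive (sym opt)))

  undominated-neighbour-covers : ¬ Dominated G h f → InN G f s → InC G h (end₁ s) ⊎ InC G h (end₂ s) →
    ∀ {x} → Incident s x → InC G h x ⊎ Incident f x
  undominated-neighbour-covers         ¬dom f∼s (inj₁ c₁) (inj₁ refl) = inj₁ c₁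
  undominated-neighbour-covers {f = f} ¬dom f∼s (inj₁ c₁) (inj₂ refl) =
    inj₂ (undominated-touches-other-end {f = f} ¬dom f∼s c₁)
  undominated-neighbour-covers {f = f} ¬dom f∼s (inj₂ c₂) (inj₁ refl) =
    inj₂ (undominated-touches-other-end {f = f} ¬dom (Sum.map Sum.swap Sum.swap f∼s) c₂)
  undominated-neighbour-covers         ¬dom f∼s (inj₂ c₂) (inj₂ refl) = inj₁ c₂

  two-new-optimal-move : Legal G h s → OptimalMove true h s →
    ∃[ s' ] (Legal G h s' × OptimalMove true h s' × CoversTwoNew G h s')
  two-new-optimal-move {h = h} {s = s} L@(f , f∼s , ¬dom) opt with covered? h (end₁ s) ⊎-dec covered? h (end₂ s)
  ... | no ¬c = s , L , opt , ¬c ∘ inj₁ , ¬c ∘ inj₂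
  ... | yes c = f , L-f , optimal-by-cover {s = s} L-f opt (undominated-neighbour-covers {f = f} {s = s} ¬dom f∼s c) ,
                undominated⇒uncovered {f = f} ¬dom (inj₁ refl) , undominated⇒uncovered {f = f} ¬dom (inj₂ refl)
    where
    L-f : Legal G h f
    L-f = undominated⇒legal {f = f} ¬dom

  module _ {P : History G → Edge G → Set}
           (choose : ∀ h → Undominated h → Σ (Edge G) λ s → Legal G h s × P h s) where

    strategyFrom : Strategy G
    strategyFrom h ¬over = let s , L , _ = choose h (undominated h ¬over) in s , L

    strategyFrom-sound : ∀ h .(¬over : ¬ Over G h) → P h (move strategyFrom h ¬over)
    strategyFrom-sound h ¬over = proj₂ (proj₂ (choose h (undominated h ¬over)))

  optimalLength : History G → ℕ
  optimalLength h = length h + value (turn h) h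

  optimalLength-snoc : turn h ≡ t → optimalLength (h ++ [ s ]) ≡ length h + valueAfter t h s
  optimalLength-snoc {h = h} {s = s} refl = begin
    length (h ++ [ s ]) + value (turn (h ++ [ s ])) (h ++ [ s ])
      ≡⟨ cong (λ l → l + value (isDTurn G l) (h ++ [ s ])) (length-++-comm h [ s ]) ⟩
    suc (length h) + value (not (turn h)) (h ++ [ s ])
      ≡⟨ +-suc (length h) _ ⟨
    length h + valueAfter (turn h) h s ∎
    where open ≡-Reasoning

  optimalLength-here : turn h ≡ t → optimalLength h ≡ length h + value t h
  optimalLength-here refl = refl

  dominator-move-≥ : turn h ≡ true → Legal G h s → optimalLength h ≤ optimalLength (h ++ [ s ])
  dominator-move-≥ {h = h} {s = s} T L = begin
    optimalLength h                 ≡⟨ optimalLength-here T ⟩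
    length h + value true h         ≤⟨ +-monoʳ-≤ (length h) (value-dominator-≤ {s = s} L) ⟩
    length h + valueAfter true h s  ≡⟨ optimalLength-snoc T ⟨
    optimalLength (h ++ [ s ])      ∎
    where open ≤-Reasoning

  staller-move-≤ : turn h ≡ false → Legal G h s → optimalLength (h ++ [ s ]) ≤ optimalLength h
  staller-move-≤ {h = h} {s = s} T L = begin
    optimalLength (h ++ [ s ])       ≡⟨ optimalLength-snoc T ⟩
    length h + valueAfter false h s  ≤⟨ +-monoʳ-≤ (length h) (value-staller-≥ {s = s} L) ⟩
    length h + value false h         ≡⟨ optimalLength-here T ⟨
    optimalLength h                  ∎
    where open ≤-Reasoning

  staller-turn⇒nonempty : turn h ≡ false → h ≢ []
  staller-turn⇒nonempty {[]} () _

  optimal-move-≡ : turn h ≡ t → OptimalMove t h s → optimalLength (h ++ [ s ]) ≡ optimalLength h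
  optimal-move-≡ {h = h} T opt =
    trans (optimalLength-snoc T) (trans (cong (length h +_) (sym opt)) (sym (optimalLength-here T)))

  module _ {σD σS : Strategy G} where

    play-length-≤ : (∀ h .(¬over : ¬ Over G h) → OptimalMove true h (move σD h ¬over)) →
      Play G σD σS h S → length S ≤ optimalLength h
    play-length-≤ opt (done _) = m≤m+n _ _
    play-length-≤ opt (moveD {h} T ¬over p) =
      ≤-trans (play-length-≤ opt p) (≤-reflexive (optimal-move-≡ {h = h} T (opt h ¬over)))
    play-length-≤ opt (moveS {h} T ¬over p) =
      ≤-trans (play-length-≤ opt p) (staller-move-≤ {h = h} T (proj₂ (σS h ¬over)))

    play-length-≥ : (∀ h .(¬over : ¬ Over G h) → OptimalMove false h (move σS h ¬over)) →
      Play G σD σS h S → optimalLength h ≤ length S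
    play-length-≥ opt (done {h} over) = ≤-reflexive (trans (cong (length h +_) (value-over {t = turn h} over)) (+-identityʳ _))
    play-length-≥ opt (moveD {h} T ¬over p) =
      ≤-trans (dominator-move-≥ {h = h} T (proj₂ (σD h ¬over))) (play-length-≥ opt p)
    play-length-≥ opt (moveS {h} T ¬over p) =
      ≤-trans (≤-reflexive (sym (optimal-move-≡ {h = h} T (opt h ¬over)))) (play-length-≥ opt p)

    play-exists : ∀ h → ∃[ S ] Play G σD σS h S
    play-exists h = go (suc (uncovered h)) h ≤-refl
      where
      go : ∀ k h → uncovered h < k → ∃[ S ] Play G σD σS h S
      go (suc k) h bound with status h | turn h in T
      ... | inj₁ over | _     = h , done over
      ... | inj₂ u    | true  =
        let ¬over = undominated⇒¬over u
            S , p = go k _ (fuel-decreases {s = move σD h ¬over} (proj₂ (σD h ¬over)) bound)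
        in S , moveD T ¬over p
      ... | inj₂ u    | false =
        let ¬over = undominated⇒¬over u
            S , p = go k _ (fuel-decreases {s = move σS h ¬over} (proj₂ (σS h ¬over)) bound)
        in S , moveS T ¬over p

    play-extends : Play G σD σS h S → ∃[ r ] S ≡ h ++ r
    play-extends (done _) = [] , sym (++-identityʳ _)
    play-extends (moveD {h} _ _ p) = let r , eq = play-extends p in _ ∷ r , trans eq (++-assoc h _ r)
    play-extends (moveS {h} _ _ p) = let r , eq = play-extends p in _ ∷ r , trans eq (++-assoc h _ r)

    module _ (Q : History G → Edge G → Set)
             (Q-dominator : ∀ h .(¬over : ¬ Over G h) → turn h ≡ true  → Q h (move σD h ¬over))
             (Q-staller   : ∀ h .(¬over : ¬ Over G h) → turn h ≡ false → Q h (move σS h ¬over)) where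

      private
        Respects : History G → History G → Set
        Respects h S = ∀ mid s post → S ≡ h ++ mid ++ s ∷ post → Q (h ++ mid) s

        respects-step : ∀ {m} → Q h m → Play G σD σS (h ++ [ m ]) S → Respects (h ++ [ m ]) S → Respects h S
        respects-step {h = h} {m = m} qm p ih [] s post eq
          with refl ← snoc-prefix-head h (trans (sym eq) (proj₂ (play-extends p))) =
          subst (λ pre → Q pre s) (sym (++-identityʳ h)) qm
        respects-step {h = h} {m = m} qm p ih (y ∷ mid) s post eq
          with refl ← snoc-prefix-head h (trans (sym eq) (proj₂ (play-extends p))) =
          subst (λ pre → Q pre s) (++-assoc h [ m ] mid)
            (ih mid s post (trans eq (sym (++-assoc h [ m ] (mid ++ s ∷ post)))))

      play-respects : Play G σD σS h S → ∀ mid s post → S ≡ h ++ mid ++ s ∷ post → Q (h ++ mid) s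
      play-respects (done {h} _) mid s post eq =
        contradiction (++-conicalʳ mid (s ∷ post) (++-identityʳ-unique h eq)) λ ()
      play-respects (moveD {h} T ¬over p) = respects-step (Q-dominator h ¬over T) p (play-respects p)
      play-respects (moveS {h} T ¬over p) = respects-step (Q-staller h ¬over T) p (play-respects p)

module DiameterAtMostOne (G : Graph)
  (diam≤1 : ∀ (e : Edge G) w → DistLe G w (end₁ e) 1 ⊎ DistLe G w (end₂ e) 1) where
  open Graph G using (adj)
  open EdgeGame G

  private
    variable
      h : History G
      s : Edge G

  CoveredOrAdjacent : History G → Vertex G → Set
  CoveredOrAdjacent h x = InC G h x ⊎ ∃[ c ] (InC G h c × adj x c ≡ true)

  near-endpoint : ∀ {e u x} → e ∈ h → Incident e u → x ≡ u ⊎ adj x u ≡ true → CoveredOrAdjacent h x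
  near-endpoint e∈h i (inj₁ refl) = inj₁ (_ , e∈h , i)
  near-endpoint e∈h i (inj₂ xu)   = inj₂ (_ , (_ , e∈h , i) , xu)

  covered-or-adjacent : h ≢ [] → ∀ x → CoveredOrAdjacent h x
  covered-or-adjacent {[]}    h≢[] x = contradiction refl h≢[]
  covered-or-adjacent {e ∷ h} _    x with diam≤1 e x
  ... | inj₁ (_ , k≤1 , w) = near-endpoint (here refl) (inj₁ refl) (walk-length≤1 w k≤1)
  ... | inj₂ (_ , k≤1 , w) = near-endpoint (here refl) (inj₂ refl) (walk-length≤1 w k≤1)

  one-new-optimal-move : h ≢ [] → Legal G h s → OptimalMove false h s →
    ∃[ s' ] (Legal G h s' × OptimalMove false h s' × CoversOneNew G h s')
  one-new-optimal-move {h = h} {s = s} h≢[] L opt with covered? h (end₁ s) | covered? h (end₂ s)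
  ... | yes c₁ | yes c₂ = contradiction (c₁ , c₂) (legal⇒not-both-covered {s = s} L)
  ... | yes c₁ | no ¬c₂ = s , L , opt , inj₁ (c₁ , ¬c₂)
  ... | no ¬c₁ | yes c₂ = s , L , opt , inj₂ (¬c₁ , c₂)
  ... | no ¬c₁ | no ¬c₂ with covered-or-adjacent h≢[] (end₁ s)
  ...   | inj₁ c₁ = contradiction c₁ ¬c₁
  ...   | inj₂ (c , c-covered , adjacent) = s' , L' , ≤-antisym value≤after-s' (value-staller-≥ {s = s'} L') ,
                                            inj₂ (¬c₁ , c-covered)
    where
    s' : Edge G
    s' = edge (end₁ s) c adjacent
    L' : Legal G h s'
    L' = s , inj₁ (inj₁ refl) , uncovered⇒undominated {f = s} ¬c₁ ¬c₂
    s'⊑s : (h ++ [ s' ]) ⊑ (h ++ [ s ])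
    s'⊑s = snoc-⊑-snoc λ { (inj₁ refl) → inj₂ (inj₁ refl) ; (inj₂ refl) → inj₁ c-covered }
    value≤after-s' : value false h ≤ valueAfter false h s'
    value≤after-s' = ≤-trans (≤-reflexive opt) (s≤s (value-antitone true s'⊑s))

  dominatorChoice : ∀ h → Undominated h →
    Σ (Edge G) λ s → Legal G h s × OptimalMove true h s × CoversTwoNew G h s
  dominatorChoice h u = let s , L , opt = optimal-move true u in two-new-optimal-move {s = s} L opt

  stallerChoice : ∀ h → Undominated h →
    Σ (Edge G) λ s → Legal G h s × OptimalMove false h s × (h ≢ [] → CoversOneNew G h s)
  stallerChoice []      u = let s , L , opt = optimal-move false u in s , L , opt , λ []≢[] → contradiction refl []≢[]
  stallerChoice (e ∷ h) u =
    let s , L , opt = optimal-move false u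
        s' , L' , opt' , one-new = one-new-optimal-move (λ ()) L opt
    in s' , L' , opt' , λ _ → one-new

  dominatorStrategy stallerStrategy : Strategy G
  dominatorStrategy = strategyFrom dominatorChoice
  stallerStrategy   = strategyFrom stallerChoice

  dominatorStrategy-guarantees : DGuarantees G dominatorStrategy (value true [])
  dominatorStrategy-guarantees σS S =
    play-length-≤ λ h ¬over → proj₁ (strategyFrom-sound dominatorChoice h ¬over)

  stallerStrategy-guarantees : SGuarantees G stallerStrategy (value true [])
  stallerStrategy-guarantees σD S =
    play-length-≥ λ h ¬over → proj₁ (strategyFrom-sound stallerChoice h ¬over)

  optimal-play-pattern : ∀ {S} → Play G dominatorStrategy stallerStrategy [] S → PatternProperty G S
  optimal-play-pattern = play-respects Pattern
    (λ h ¬over T → (λ _ → proj₂ (strategyFrom-sound dominatorChoice h ¬over)) , λ F → contradiction (trans (sym T) F) λ ())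
    (λ h ¬over F → (λ T → contradiction (trans (sym T) F) λ ()) ,
                   λ _ → proj₂ (strategyFrom-sound stallerChoice h ¬over) (staller-turn⇒nonempty F))
    where
    Pattern : History G → Edge G → Set
    Pattern pre s = (turn pre ≡ true → CoversTwoNew G pre s) × (turn pre ≡ false → CoversOneNew G pre s)

  optimal-play : ∃[ S ] (Play G dominatorStrategy stallerStrategy [] S × length S ≡ value true [] × PatternProperty G S)
  optimal-play =
    let S , play = play-exists [] in
    S , play ,
    ≤-antisym (dominatorStrategy-guarantees stallerStrategy S play) (stallerStrategy-guarantees dominatorStrategy S play) ,
    optimal-play-pattern play

proposition4 : (G : Graph) → Connected G → VEDiam G 1 →
    ∃[ γ ] (GameValue G γ ×
      ∃[ σD ] ∃[ σS ] (DGuarantees G σD γ × SGuarantees G σS γ ×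
        ∃[ S ] (Play G σD σS [] S × length S ≡ γ × PatternProperty G S)))
proposition4 G _ (diam≤1 , _) =
  value true [] ,
  ((dominatorStrategy , dominatorStrategy-guarantees) , (stallerStrategy , stallerStrategy-guarantees)) ,
  dominatorStrategy , stallerStrategy , dominatorStrategy-guarantees , stallerStrategy-guarantees ,
  optimal-play
  where
  open EdgeGame G using (value)
  open DiameterAtMostOne G diam≤1
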